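{- Let $n\ge 2$. (A) If $\mathbf{r}=(r_1,\dots,r_n)$ is an arithmetical $r$-structure on $\mathcal{C}_n$ with $r_j=1$ for some $1\le j\le n$, then $(r_j,r_{j+1},\dots,r_n,r_1,\dots,r_j)$ is an arithmetical $r$-structure on $\mathcal{P}_{n+1}$. (B) If $\mathbf{r}=(r_1,\dots,r_n)$ is an arithmetical $r$-structure on $\mathcal{C}_n$ with $r_\alpha=r_\beta=1$ for some $1\le\alpha<\beta\le n$, then $(r_\alpha,r_{\alpha+1},\dots,r_\beta)$ is an arithmetical $r$-structure on $\mathcal{P}_{\beta-\alpha+1}$ and $(r_\beta,r_{\beta+1},\dots,r_n,r_1,\dots,r_\alpha)$ is an arithmetical $r$-structure on $\mathcal{P}_{n-(\beta-\alpha)+1}$.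
   Context: $\mathcal{P}_N$ is the path graph with vertices $1,\dots,N$ and edges $\{i,i+1\}$. For $n\ge 3$, $\mathcal{C}_n$ is the cycle graph with vertices $1,\dots,n$ and edges $\{i,i+1\}$ (indices mod $n$); $\mathcal{C}_2$ is two vertices joined by two parallel edges (adjacency matrix $\begin{pmatrix}0&2\\2&0\end{pmatrix}$). An arithmetical structure on a graph $G$ with $N$ vertices and adjacency matrix $A$ is a pair $(\mathbf{d},\mathbf{r})$ of positive integer vectors in $\mathbb{Z}^N$ with $\mathbf{r}$ primitive (gcd of entries $1$) and $(\operatorname{diag}(\mathbf{d})-A)\mathbf{r}=\mathbf{0}$; $\mathbf{r}$ is then an arithmetical $r$-structure on $G$. -}

module Defs where

open import Data.Nat using (ℕ; zero; suc; _+_; _*_; _<_; _≡ᵇ_)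
open import Data.Nat.GCD using (gcd)
open import Data.Nat.DivMod using (_mod_)
open import Data.Fin using (Fin; toℕ) renaming (zero to fz; suc to fs)
open import Data.Bool using (if_then_else_)
open import Data.Product using (∃)
open import Relation.Binary.PropositionalEquality using (_≡_)

∑ : ∀ {n} → (Fin n → ℕ) → ℕ
∑ {zero}  f = 0
∑ {suc n} f = f fz + ∑ (λ i → f (fs i))

gcdAll : ∀ {n} → (Fin n → ℕ) → ℕ
gcdAll {zero}  f = 0
gcdAll {suc n} f = gcd (f fz) (gcdAll (λ i → f (fs i)))

[_≡?_] : ℕ → ℕ → ℕ
[ a ≡? b ] = if a ≡ᵇ b then 1 else 0

-- adjacency matrix of the path P_N on vertices 0..N-1 (paper: 1..N), edges {i,i+1}
pathAdj : (N : ℕ) → Fin N → Fin N → ℕ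
pathAdj N i j = [ toℕ j ≡? suc (toℕ i) ] + [ toℕ i ≡? suc (toℕ j) ]

-- For n ≥ 3 this is the usual 0/1 cycle matrix; for n = 2 it gives
-- the matrix ((0,2),(2,0)) (two parallel edges), as in the paper.
cycleAdj : (n : ℕ) → Fin n → Fin n → ℕ
cycleAdj zero    i j = 0
cycleAdj (suc m) i j =
  [ toℕ j ≡? toℕ ((suc (toℕ i)) mod (suc m)) ] + [ toℕ i ≡? toℕ ((suc (toℕ j)) mod (suc m)) ]

record IsArithStructure {N : ℕ} (A : Fin N → Fin N → ℕ) (d r : Fin N → ℕ) : Set where
  field
    d-pos     : ∀ i → 0 < d i
    r-pos     : ∀ i → 0 < r i
    r-primitive : gcdAll r ≡ 1
    balance   : ∀ i → d i * r i ≡ ∑ (λ j → A i j * r j)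

IsRStructure : {N : ℕ} → (Fin N → Fin N → ℕ) → (Fin N → ℕ) → Set
IsRStructure A r = ∃ λ d → IsArithStructure A d r

-- cyclic indexing: cyc r k = r (k mod n) (0-based); cyc on n = 0 is 0 (unused)
cyc : ∀ {n} → (Fin n → ℕ) → ℕ → ℕ
cyc {zero}  r k = 0
cyc {suc m} r k = r (k mod (suc m))

module Submission where

open import Defs
open import Data.Nat using (ℕ; zero; suc; _+_; _*_; _∸_; _≤_; _<_; z≤n; s≤s; _%_; _≟_; NonZero)
open import Data.Nat.Properties
  using (+-identityʳ; *-identityˡ; *-identityʳ; *-distribʳ-+; +-suc; +-comm; +-assoc;
         +-commutativeSemigroup; ≤∧≢⇒<; <⇒≢; <⇒≤; ≤-<-trans; m<n⇒m<1+n;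
         m<n⇒0<n∸m; m+[n∸m]≡n; m∸n≤m)
open import Data.Nat.DivMod using (_mod_; %-distribˡ-+; m%n%n≡m%n; [m+n]%n≡m%n; m<n⇒m%n≡m)
open import Data.Nat.GCD using (gcd; gcd-zeroˡ)
open import Data.Fin using (Fin; toℕ; fromℕ<) renaming (zero to fz; suc to fs)
open import Data.Fin.Properties using (toℕ-injective; toℕ-fromℕ<; toℕ<n; 0≢1+n)
  renaming (suc-injective to fs-injective)
open import Data.Product using (_×_; _,_)
open import Data.Empty using (⊥-elim)
open import Function using (_∘_)
open import Function.Definitions using (Injective)
open import Relation.Nullary using (yes; no)
open import Relation.Binary.PropositionalEquality
open import Algebra.Properties.CommutativeSemigroup +-commutativeSemigroup using (interchange)
open ≡-Reasoning

-- Unroll the cycle along ℕ: the balance equations of C_n say that the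
-- n-periodic sequences d, r satisfy d_t r_t = r_{t+1} + r_{t-1} for every t.
-- Any window r_s, …, r_{s+ℓ} of a positive solution of this recurrence that
-- starts and ends with 1 is an r-structure on P_{ℓ+1}: the interior balance
-- equations are inherited, at the two ends r = 1 lets one choose d_0 = r_1 and
-- d_ℓ = r_{ℓ-1}, and the entry 1 makes the window primitive.

indicator-refl : ∀ a → [ a ≡? a ] ≡ 1
indicator-refl zero    = refl
indicator-refl (suc a) = indicator-refl a

indicator-≢ : ∀ {a b} → a ≢ b → [ a ≡? b ] ≡ 0
indicator-≢ {zero}  {zero}  a≢b = ⊥-elim (a≢b refl)
indicator-≢ {zero}  {suc b} _   = refl
indicator-≢ {suc a} {zero}  _   = refl
indicator-≢ {suc a} {suc b} a≢b = indicator-≢ (a≢b ∘ cong suc)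

indicator-sym : ∀ a b → [ a ≡? b ] ≡ [ b ≡? a ]
indicator-sym a b with a ≟ b
... | yes refl = refl
... | no a≢b   = trans (indicator-≢ a≢b) (sym (indicator-≢ (a≢b ∘ sym)))

∑-cong : ∀ {N} {f g : Fin N → ℕ} → (∀ i → f i ≡ g i) → ∑ f ≡ ∑ g
∑-cong {zero}  f≗g = refl
∑-cong {suc N} f≗g = cong₂ _+_ (f≗g fz) (∑-cong (f≗g ∘ fs))

∑-distrib-+ : ∀ {N} (f g : Fin N → ℕ) → ∑ (λ i → f i + g i) ≡ ∑ f + ∑ g
∑-distrib-+ {zero}  f g = refl
∑-distrib-+ {suc N} f g =
  trans (cong (f fz + g fz +_) (∑-distrib-+ (f ∘ fs) (g ∘ fs)))
        (interchange (f fz) (g fz) (∑ (f ∘ fs)) (∑ (g ∘ fs)))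

∑-distribʳ-+ : ∀ {N} (g h f : Fin N → ℕ) →
  ∑ (λ i → (g i + h i) * f i) ≡ ∑ (λ i → g i * f i) + ∑ (λ i → h i * f i)
∑-distribʳ-+ g h f =
  trans (∑-cong (λ i → *-distribʳ-+ (f i) (g i) (h i))) (∑-distrib-+ (λ i → g i * f i) (λ i → h i * f i))

∑-zero : ∀ {N} (f : Fin N → ℕ) → (∀ i → f i ≡ 0) → ∑ f ≡ 0
∑-zero {zero}  f f≗0 = refl
∑-zero {suc N} f f≗0 = cong₂ _+_ (f≗0 fz) (∑-zero (f ∘ fs) (f≗0 ∘ fs))

∑-indicator-absent : ∀ {N a} (h f : Fin N → ℕ) → (∀ j → h j ≢ a) →
  ∑ (λ j → [ a ≡? h j ] * f j) ≡ 0
∑-indicator-absent h f h≢a =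
  ∑-zero _ (λ j → cong (_* f j) (indicator-≢ (h≢a j ∘ sym)))

∑-indicator : ∀ {N a} (h f : Fin N → ℕ) → Injective _≡_ _≡_ h →
  (p : Fin N) → h p ≡ a → ∑ (λ j → [ a ≡? h j ] * f j) ≡ f p
∑-indicator {suc N} h f h-inj fz refl =
  trans (cong₂ _+_ (trans (cong (_* f fz) (indicator-refl (h fz))) (*-identityˡ (f fz)))
                   (∑-indicator-absent (h ∘ fs) (f ∘ fs) (λ j e → 0≢1+n (sym (h-inj e)))))
        (+-identityʳ (f fz))
∑-indicator {suc N} h f h-inj (fs p) hp≡a =
  cong₂ _+_ (cong (_* f fz) (indicator-≢ (λ a≡h0 → 0≢1+n (h-inj (trans (sym a≡h0) (sym hp≡a))))))
            (∑-indicator (h ∘ fs) (f ∘ fs) (fs-injective ∘ h-inj) p hp≡a)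

∑-pick : ∀ {N a} (G : ℕ → ℕ) → a < N → ∑ {N} (λ j → [ a ≡? toℕ j ] * G (toℕ j)) ≡ G a
∑-pick G a<N =
  trans (∑-indicator toℕ (G ∘ toℕ) toℕ-injective (fromℕ< a<N) (toℕ-fromℕ< a<N))
        (cong G (toℕ-fromℕ< a<N))

∑-pick-out : ∀ N (G : ℕ → ℕ) → ∑ {N} (λ j → [ N ≡? toℕ j ] * G (toℕ j)) ≡ 0
∑-pick-out N G = ∑-indicator-absent {N} toℕ (G ∘ toℕ) (λ j → <⇒≢ (toℕ<n j))

∑-pathAdj : ∀ {N} (k : Fin N) (f : Fin N → ℕ) →
  ∑ (λ j → pathAdj N k j * f j)
    ≡ ∑ (λ j → [ suc (toℕ k) ≡? toℕ j ] * f j) + ∑ (λ j → [ toℕ k ≡? suc (toℕ j) ] * f j)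
∑-pathAdj {N} k f = begin
  ∑ (λ j → pathAdj N k j * f j)
    ≡⟨ ∑-cong (λ j → cong (λ e → (e + [ toℕ k ≡? suc (toℕ j) ]) * f j)
                          (indicator-sym (toℕ j) (suc (toℕ k)))) ⟩
  ∑ (λ j → ([ suc (toℕ k) ≡? toℕ j ] + [ toℕ k ≡? suc (toℕ j) ]) * f j)
    ≡⟨ ∑-distribʳ-+ (λ j → [ suc (toℕ k) ≡? toℕ j ]) (λ j → [ toℕ k ≡? suc (toℕ j) ]) f ⟩
  ∑ (λ j → [ suc (toℕ k) ≡? toℕ j ] * f j) + ∑ (λ j → [ toℕ k ≡? suc (toℕ j) ] * f j) ∎

[m+n%d]%d≡[m+n]%d : ∀ m n d .{{_ : NonZero d}} → (m + n % d) % d ≡ (m + n) % d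
[m+n%d]%d≡[m+n]%d m n d = begin
  (m + n % d) % d           ≡⟨ %-distribˡ-+ m (n % d) d ⟩
  (m % d + n % d % d) % d   ≡⟨ cong (λ x → (m % d + x) % d) (m%n%n≡m%n n d) ⟩
  (m % d + n % d) % d       ≡⟨ sym (%-distribˡ-+ m n d) ⟩
  (m + n) % d               ∎

-- cycleAdj (suc m) i j is definitionally [ toℕ j ≡? toℕ (next i) ] + [ toℕ i ≡? toℕ (next j) ].
next : ∀ {m} → Fin (suc m) → Fin (suc m)
next {m} i = suc (toℕ i) mod suc m

next-mod : ∀ {m} x → next (x mod suc m) ≡ suc x mod suc m
next-mod {m} x = toℕ-injective (begin
  toℕ (next (x mod suc m))        ≡⟨ toℕ-fromℕ< _ ⟩
  suc (toℕ (x mod suc m)) % suc m ≡⟨ cong (λ y → suc y % suc m) (toℕ-fromℕ< _) ⟩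
  suc (x % suc m) % suc m         ≡⟨ [m+n%d]%d≡[m+n]%d 1 x (suc m) ⟩
  suc x % suc m                   ≡⟨ sym (toℕ-fromℕ< _) ⟩
  toℕ (suc x mod suc m)           ∎)

next-injective : ∀ {m} → Injective _≡_ _≡_ (next {m})
next-injective {m} {i} {j} next[i]≡next[j] =
  toℕ-injective (begin
    toℕ i                      ≡⟨ sym (undo-next i) ⟩
    (m + toℕ (next i)) % suc m ≡⟨ cong (λ k → (m + toℕ k) % suc m) next[i]≡next[j] ⟩
    (m + toℕ (next j)) % suc m ≡⟨ undo-next j ⟩
    toℕ j                      ∎)
  where
  undo-next : ∀ k → (m + toℕ (next k)) % suc m ≡ toℕ k
  undo-next k = begin
    (m + toℕ (next k)) % suc m        ≡⟨ cong (λ y → (m + y) % suc m) (toℕ-fromℕ< _) ⟩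
    (m + suc (toℕ k) % suc m) % suc m ≡⟨ [m+n%d]%d≡[m+n]%d m (suc (toℕ k)) (suc m) ⟩
    (m + suc (toℕ k)) % suc m         ≡⟨ cong (_% suc m) (trans (+-suc m (toℕ k)) (+-comm (suc m) (toℕ k))) ⟩
    (toℕ k + suc m) % suc m           ≡⟨ [m+n]%n≡m%n (toℕ k) (suc m) ⟩
    toℕ k % suc m                     ≡⟨ m<n⇒m%n≡m (toℕ<n k) ⟩
    toℕ k                             ∎

∑-cycleAdj : ∀ {m} (i p : Fin (suc m)) → next p ≡ i → (f : Fin (suc m) → ℕ) →
  ∑ (λ j → cycleAdj (suc m) i j * f j) ≡ f (next i) + f p
∑-cycleAdj {m} i p next[p]≡i f = begin
  ∑ (λ j → cycleAdj (suc m) i j * f j)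
    ≡⟨ ∑-cong (λ j → cong (λ e → (e + [ toℕ i ≡? toℕ (next j) ]) * f j)
                          (indicator-sym (toℕ j) (toℕ (next i)))) ⟩
  ∑ (λ j → ([ toℕ (next i) ≡? toℕ j ] + [ toℕ i ≡? toℕ (next j) ]) * f j)
    ≡⟨ ∑-distribʳ-+ (λ j → [ toℕ (next i) ≡? toℕ j ]) (λ j → [ toℕ i ≡? toℕ (next j) ]) f ⟩
  ∑ (λ j → [ toℕ (next i) ≡? toℕ j ] * f j) + ∑ (λ j → [ toℕ i ≡? toℕ (next j) ] * f j)
    ≡⟨ cong₂ _+_ (∑-indicator toℕ f toℕ-injective (next i) refl)
                 (∑-indicator (toℕ ∘ next) f (next-injective ∘ toℕ-injective) p (cong toℕ next[p]≡i)) ⟩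
  f (next i) + f p ∎

IsBalanced : (D R : ℕ → ℕ) → Set
IsBalanced D R = ∀ t → D (suc t) * R (suc t) ≡ R (suc (suc t)) + R t

IsBalanced-shift : ∀ {D R} → IsBalanced D R → ∀ s → IsBalanced (λ t → D (s + t)) (λ t → R (s + t))
IsBalanced-shift {D} {R} balanced s t = begin
  D (s + suc t) * R (s + suc t)       ≡⟨ cong (λ u → D u * R u) (+-suc s t) ⟩
  D (suc (s + t)) * R (suc (s + t))   ≡⟨ balanced (s + t) ⟩
  R (suc (suc (s + t))) + R (s + t)   ≡⟨ cong (λ u → R u + R (s + t)) s+[2+t]≡2+[s+t] ⟨
  R (s + suc (suc t)) + R (s + t)     ∎
  where
  s+[2+t]≡2+[s+t] : s + suc (suc t) ≡ suc (suc (s + t))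
  s+[2+t]≡2+[s+t] = trans (+-suc s (suc t)) (cong suc (+-suc s t))

cycle-balanced : ∀ {m} {d r : Fin (suc m) → ℕ} →
  IsArithStructure (cycleAdj (suc m)) d r → IsBalanced (cyc d) (cyc r)
cycle-balanced {m} {d} {r} st t = begin
  d i * r i                                  ≡⟨ IsArithStructure.balance st i ⟩
  ∑ (λ j → cycleAdj (suc m) i j * r j)       ≡⟨ ∑-cycleAdj i (t mod suc m) (next-mod t) r ⟩
  r (next i) + r (t mod suc m)               ≡⟨ cong (λ k → r k + r (t mod suc m)) (next-mod (suc t)) ⟩
  r (suc (suc t) mod suc m) + r (t mod suc m) ∎
  where i = suc t mod suc m

head≡1⇒gcdAll≡1 : ∀ {N} (f : Fin (suc N) → ℕ) → f fz ≡ 1 → gcdAll f ≡ 1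
head≡1⇒gcdAll≡1 f f₀≡1 =
  trans (cong (λ a → gcd a (gcdAll (f ∘ fs))) f₀≡1) (gcd-zeroˡ (gcdAll (f ∘ fs)))

path-rStructure : ∀ {D R : ℕ → ℕ} → (∀ t → 0 < D t) → (∀ t → 0 < R t) → IsBalanced D R →
  ∀ ℓ → 0 < ℓ → R 0 ≡ 1 → R ℓ ≡ 1 → IsRStructure (pathAdj (suc ℓ)) (λ k → R (toℕ k))
path-rStructure {D} {R} D-pos R-pos balanced (suc m) _ R₀≡1 Rₗ≡1 = (d ∘ toℕ) , record
  { d-pos       = d-pos ∘ toℕ
  ; r-pos       = R-pos ∘ toℕ
  ; r-primitive = head≡1⇒gcdAll≡1 {suc m} (R ∘ toℕ) R₀≡1
  ; balance     = λ k → trans (row (toℕ k) (toℕ<n k)) (sym (∑-pathAdj k (R ∘ toℕ)))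
  }
  where
  N = suc (suc m)

  pick : ℕ → ℕ
  pick a = ∑ {N} (λ j → [ a ≡? toℕ j ] * R (toℕ j))

  d : ℕ → ℕ
  d zero = R 1
  d (suc x) with x ≟ m
  ... | yes _ = R m
  ... | no _  = D (suc x)

  d-pos : ∀ x → 0 < d x
  d-pos zero = R-pos 1
  d-pos (suc x) with x ≟ m
  ... | yes _ = R-pos m
  ... | no _  = D-pos (suc x)

  -- at row suc x the second sum is definitionally pick x
  row : ∀ a → a < N → d a * R a ≡ pick (suc a) + ∑ {N} (λ j → [ a ≡? suc (toℕ j) ] * R (toℕ j))
  row zero _ = begin
    R 1 * R 0   ≡⟨ cong (R 1 *_) R₀≡1 ⟩
    R 1 * 1     ≡⟨ *-identityʳ (R 1) ⟩
    R 1         ≡⟨ sym (∑-pick {N} R (s≤s (s≤s z≤n))) ⟩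
    pick 1      ≡⟨ sym (+-identityʳ (pick 1)) ⟩
    pick 1 + 0  ≡⟨ cong (pick 1 +_) (sym (∑-indicator-absent {N} {0} (suc ∘ toℕ) (R ∘ toℕ) (λ _ ()))) ⟩
    pick 1 + ∑ {N} (λ j → [ 0 ≡? suc (toℕ j) ] * R (toℕ j)) ∎
  row (suc x) (s≤s (s≤s x≤m)) with x ≟ m
  ... | yes refl = begin
    R x * R (suc x)    ≡⟨ cong (R x *_) Rₗ≡1 ⟩
    R x * 1            ≡⟨ *-identityʳ (R x) ⟩
    R x                ≡⟨ sym (∑-pick {N} R (m<n⇒m<1+n (s≤s x≤m))) ⟩
    pick x             ≡⟨ cong (_+ pick x) (sym (∑-pick-out N R)) ⟩
    pick N + pick x    ∎
  ... | no x≢m = begin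
    D (suc x) * R (suc x)   ≡⟨ balanced x ⟩
    R (suc (suc x)) + R x   ≡⟨ sym (cong₂ _+_ (∑-pick {N} R (s≤s (s≤s (≤∧≢⇒< x≤m x≢m))))
                                              (∑-pick {N} R (m<n⇒m<1+n (s≤s x≤m)))) ⟩
    pick (suc (suc x)) + pick x ∎

cycle-segment-rStructure : ∀ {m} {r : Fin (suc m) → ℕ} → IsRStructure (cycleAdj (suc m)) r →
  (s ℓ : ℕ) → 0 < ℓ → cyc r s ≡ 1 → cyc r (s + ℓ) ≡ 1 →
  IsRStructure (pathAdj (suc ℓ)) (λ k → cyc r (s + toℕ k))
cycle-segment-rStructure {m} {r} (d , st) s ℓ 0<ℓ rₛ≡1 rₛ₊ₗ≡1 =
  path-rStructure {λ t → cyc d (s + t)} {λ t → cyc r (s + t)}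
                  (λ t → d-pos ((s + t) mod suc m)) (λ t → r-pos ((s + t) mod suc m))
                  (IsBalanced-shift {cyc d} {cyc r} (cycle-balanced st) s) ℓ 0<ℓ
                  (trans (cong (cyc r) (+-identityʳ s)) rₛ≡1) rₛ₊ₗ≡1
  where open IsArithStructure st

cyc-toℕ : ∀ {m} (r : Fin (suc m) → ℕ) (j : Fin (suc m)) → cyc r (toℕ j) ≡ r j
cyc-toℕ r j = cong r (toℕ-injective (trans (toℕ-fromℕ< _) (m<n⇒m%n≡m (toℕ<n j))))

cyc-periodic : ∀ {m} (r : Fin (suc m) → ℕ) x → cyc r (x + suc m) ≡ cyc r x
cyc-periodic {m} r x =
  cong r (toℕ-injective (trans (toℕ-fromℕ< _) (trans ([m+n]%n≡m%n x (suc m)) (sym (toℕ-fromℕ< _)))))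

-- The hypothesis n ≥ 2 is only used to exclude n = 0.
lemma3p9 : (n : ℕ) → 2 ≤ n → (r : Fin n → ℕ) → IsRStructure (cycleAdj n) r →
    ((j : Fin n) → r j ≡ 1 →
    IsRStructure (pathAdj (suc n)) (λ k → cyc r (toℕ j + toℕ k)))
    × ((α β : Fin n) → toℕ α < toℕ β → r α ≡ 1 → r β ≡ 1 →
    IsRStructure (pathAdj (suc (toℕ β ∸ toℕ α))) (λ k → cyc r (toℕ α + toℕ k))
    × IsRStructure (pathAdj (suc (n ∸ (toℕ β ∸ toℕ α)))) (λ k → cyc r (toℕ β + toℕ k)))
lemma3p9 zero ()
lemma3p9 (suc m) _ r r-str =
    (λ j rⱼ≡1 → segment (toℕ j) (suc m) (s≤s z≤n) (one j rⱼ≡1)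
                   (trans (cyc-periodic r (toℕ j)) (one j rⱼ≡1)))
  , (λ α β α<β r_α≡1 r_β≡1 →
        segment (toℕ α) (toℕ β ∸ toℕ α) (m<n⇒0<n∸m α<β) (one α r_α≡1)
          (trans (cong (cyc r) (m+[n∸m]≡n (<⇒≤ α<β))) (one β r_β≡1))
      , segment (toℕ β) (suc m ∸ (toℕ β ∸ toℕ α)) (m<n⇒0<n∸m (gap<n α β)) (one β r_β≡1)
          (trans (cong (cyc r) (wrap-around α β α<β))
                 (trans (cyc-periodic r (toℕ α)) (one α r_α≡1))))
  where
  segment = cycle-segment-rStructure r-str

  one : ∀ j → r j ≡ 1 → cyc r (toℕ j) ≡ 1
  one j = trans (cyc-toℕ r j)

  gap<n : ∀ (α β : Fin (suc m)) → toℕ β ∸ toℕ α < suc m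
  gap<n α β = ≤-<-trans (m∸n≤m (toℕ β) (toℕ α)) (toℕ<n β)

  wrap-around : ∀ α β → toℕ α < toℕ β →
    toℕ β + (suc m ∸ (toℕ β ∸ toℕ α)) ≡ toℕ α + suc m
  wrap-around α β α<β = begin
    toℕ β + (suc m ∸ δ)        ≡⟨ cong (_+ (suc m ∸ δ)) (sym (m+[n∸m]≡n (<⇒≤ α<β))) ⟩
    toℕ α + δ + (suc m ∸ δ)    ≡⟨ +-assoc (toℕ α) δ (suc m ∸ δ) ⟩
    toℕ α + (δ + (suc m ∸ δ))  ≡⟨ cong (toℕ α +_) (m+[n∸m]≡n (<⇒≤ (gap<n α β))) ⟩
    toℕ α + suc m              ∎
    where δ = toℕ β ∸ toℕ α
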